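{- Let $\varphi^{\mathcal{T}}(\overline{x},\overline{y})$ be a realizable $\mathrm{LTL}^{\mathcal{T}}$ specification, $\varphi^{\mathbb{B}}$ its Boolean abstraction, $\alpha$ a partitioner, $\Gamma$ an adaptive provider description with extra variables $\overline{z}$, and $\beta_\Gamma$ an adaptive provider. Let $\rho^{\mathbb{B}}$ be a winning strategy for $\varphi^{\mathbb{B}}$ and $\rho^{\mathcal{T}}_\Gamma$ the combined adaptive strategy of $\alpha$, $\rho^{\mathbb{B}}$ and $\beta_\Gamma$. Then $\rho^{\mathcal{T}}_\Gamma$ is winning for $\varphi^{\mathcal{T}}$, i.e. for every sequence of environment inputs $(v_{x,i},v_{z,i})_{i\ge0}$, the trace of valuations $(v_{x,i},v_{y,i})_{i\ge0}$ it produces satisfies $\varphi^{\mathcal{T}}$.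
   Context: Let $\mathcal{T}$ be a first-order theory with domain $\mathbb{D}$. An $\mathrm{LTL}^{\mathcal{T}}$ formula is an LTL formula whose atoms are $\mathcal{T}$-literals $l_1,\dots,l_n$, with variables split into disjoint environment variables $\overline{x}$ and system variables $\overline{y}$; $\mathrm{val}(\overline{x})$ is the set of maps $\overline{x}\to\mathbb{D}$ (similarly for other variable sets). A literal holds at a trace position iff the valuation there makes it true; other operators have standard LTL semantics. A system strategy is $\langle Q,q_0,\delta,o\rangle$ with $Q$ finite, $\delta:Q\times I\to Q$, $o:Q\times I\to O$ (for input set $I$, output set $O$); on inputs $i_0i_1\dots$ it outputs $o(q_k,i_k)$ with $q_{k+1}=\delta(q_k,i_k)$; it is winning if all resulting traces satisfy the specification; a specification is realizable if a winning strategy exists. Same notions for propositional LTL with Boolean environment propositions $\overline{e}$ and system propositions $\overline{s}$. Boolean abstraction: fresh system propositions $\overline{s}=\{s_1,\dots,s_n\}$; a choice is $c\subseteq\overline{s}$ (identified with a valuation of $\overline{s}$) with $f_c(\overline{x},\overline{y})=\bigwedge_{s_i\in c}l_i\wedge\bigwedge_{s_i\notin c}\neg l_i$; a reaction $r$ is a set of choices with $f_r(\overline{x})=\bigwedge_{c\in r}\exists\overline{y}.f_c\wedge\bigwedge_{c\notin r}\forall\overline{y}.\neg f_c$, valid if $\exists\overline{x}.f_r$ holds; each valid $r$ gets a fresh environment proposition $e_r$; $\varphi^{\mathbb{B}}=\varphi^{\mathcal{T}}[l_i\leftarrow s_i]\wedge\square(\varphi^{legal}\to\varphi^{extra})$ with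 $\varphi^{legal}$ saying exactly one $e_r$ is true and $\varphi^{extra}=\bigwedge_r(e_r\to\bigvee_{c\in r}(\bigwedge_{s_i\in c}s_i\wedge\bigwedge_{s_i\notin c}\neg s_i))$. A partitioner is a function $\alpha:\mathrm{val}(\overline{x})\to\overline{e}$ with $\alpha(v_x)=e_r$ whenever $r$ is valid and $f_r(v_x)$ is true (identified with the valuation of $\overline{e}$ making only $\alpha(v_x)$ true). Let $\overline{z}$ be a set of variables disjoint from $\overline{x},\overline{y}$. An adaptive provider description is a family $\Gamma=\{\psi^+_{(r,c)}\}$ containing, for each valid reaction $r$ and choice $c\in r$, a formula $\psi^+_{(r,c)}(\overline{x},\overline{z},\overline{y})$ (free variables among $\overline{x},\overline{z},\overline{y}$) such that $\forall\overline{x},\overline{z}.\exists\overline{y}.[(f_r(\overline{x})\to f_c(\overline{x},\overline{y}))\wedge\psi^+_{(r,c)}]$ is valid. An adaptive provider is a function $\beta_\Gamma:\mathrm{val}(\overline{x})\times\mathrm{val}(\overline{z})\times\mathrm{val}(\overline{s})\to\mathrm{val}(\overline{y})$ such that for every $v_x$, $v_z$, valid reaction $r$ with $f_r(v_x)$ true and choice $c\in r$, $f_c(\overline{x}\leftarrow v_x,\overline{y}\leftarrow\beta_\Gamma(v_x,v_z,c))$ is true. For $\rho^{\mathbb{B}}=\langle Q,q_0,\delta,o\rangle$, the combined adaptive strategy $\rho^{\mathcal{T}}_\Gamma=\langle Q,q_0,\delta',o'\rangle$ takes inputs $(v_x,v_z)\in\mathrm{val}(\overline{x})\times\mathrm{val}(\overline{z})$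 (both chosen by the environment) and is defined by $\delta'(q,(v_x,v_z))=\delta(q,\alpha(v_x))$ and $o'(q,(v_x,v_z))=\beta_\Gamma(v_x,v_z,o(q,\alpha(v_x)))$. -}

module Defs where

open import Level using (0ℓ)
open import Data.Nat using (ℕ; zero; suc; _≤_; _<_)
open import Data.Fin using (Fin)
open import Data.Bool using (Bool; true; false; T; _∧_)
open import Data.Bool.Properties using () renaming (_≟_ to _≟B_)
open import Data.Vec using (Vec; []; _∷_; lookup)
open import Data.Product using (Σ; ∃; ∃-syntax; Σ-syntax; _×_; _,_; proj₁; proj₂)
open import Data.Sum using (_⊎_; inj₁; inj₂)
open import Data.Unit using (⊤)
open import Relation.Nullary using (¬_)
open import Relation.Nullary.Decidable using (⌊_⌋)
open import Relation.Binary.PropositionalEquality using (_≡_)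

infixr 6 _∧ℓ_
infixr 5 _Uℓ_

data LTL (A : Set) : Set where
  ttℓ  : LTL A
  atom : A → LTL A
  ¬ℓ_  : LTL A → LTL A
  _∧ℓ_ : LTL A → LTL A → LTL A
  Xℓ_  : LTL A → LTL A
  _Uℓ_ : LTL A → LTL A → LTL A

mapLTL : ∀ {A B : Set} → (A → B) → LTL A → LTL B
mapLTL g ttℓ = ttℓ
mapLTL g (atom a) = atom (g a)
mapLTL g (¬ℓ φ) = ¬ℓ mapLTL g φ
mapLTL g (φ ∧ℓ ψ) = mapLTL g φ ∧ℓ mapLTL g ψ
mapLTL g (Xℓ φ) = Xℓ mapLTL g φ
mapLTL g (φ Uℓ ψ) = mapLTL g φ Uℓ mapLTL g ψ

Sat : {A S : Set} → (A → S → Set) → (ℕ → S) → ℕ → LTL A → Set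
Sat ⟦_⟧ σ i ttℓ = ⊤
Sat ⟦_⟧ σ i (atom a) = ⟦ a ⟧ (σ i)
Sat ⟦_⟧ σ i (¬ℓ φ) = ¬ Sat ⟦_⟧ σ i φ
Sat ⟦_⟧ σ i (φ ∧ℓ ψ) = Sat ⟦_⟧ σ i φ × Sat ⟦_⟧ σ i ψ
Sat ⟦_⟧ σ i (Xℓ φ) = Sat ⟦_⟧ σ (suc i) φ
Sat ⟦_⟧ σ i (φ Uℓ ψ) =
  ∃[ k ] (i ≤ k × Sat ⟦_⟧ σ k ψ × (∀ j → i ≤ j → j < k → Sat ⟦_⟧ σ j φ))

record Strategy (I O : Set) : Set where
  field
    size : ℕ
    q₀   : Fin size
    δ    : Fin size → I → Fin size
    o    : Fin size → I → O

module _ {I O : Set} (ρ : Strategy I O) where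
  open Strategy ρ

  stateAt : (ℕ → I) → ℕ → Fin size
  stateAt ι zero = q₀
  stateAt ι (suc k) = δ (stateAt ι k) (ι k)

  outAt : (ℕ → I) → ℕ → O
  outAt ι k = o (stateAt ι k) (ι k)

-- Reactions: sets of choices (choices = Vec Bool n = valuations of s̄),
-- represented canonically as complete binary trees of Booleans.

Pow : ℕ → Set
Pow zero = Bool
Pow (suc n) = Pow n × Pow n

mem : ∀ {n} → Pow n → Vec Bool n → Bool
mem {zero} b [] = b
mem {suc n} (t , f) (true ∷ c) = mem t c
mem {suc n} (t , f) (false ∷ c) = mem f c

eqPow : ∀ {n} → Pow n → Pow n → Bool
eqPow {zero} a b = ⌊ a ≟B b ⌋
eqPow {suc n} (a , b) (c , d) = eqPow a c ∧ eqPow b d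

litVal : Bool → Set → Set
litVal true P = P
litVal false P = ¬ P

record Spec : Set₁ where
  field
    D   : Set
    n   : ℕ
    nx  : ℕ
    ny  : ℕ
    lit : Fin n → (Fin nx → D) → (Fin ny → D) → Set

module Setup (𝒯 : Spec) (nz : ℕ) where
  open Spec 𝒯

  ValX ValY ValZ : Set
  ValX = Fin nx → D
  ValY = Fin ny → D
  ValZ = Fin nz → D

  Choice : Set          -- a choice c ⊆ s̄, identified with a valuation of s̄
  Choice = Vec Bool n

  Reaction : Set
  Reaction = Pow n

  fc : Choice → ValX → ValY → Set
  fc c vx vy = ∀ i → litVal (lookup c i) (lit i vx vy)

  fr : Reaction → ValX → Set
  fr r vx = ∀ c → (T (mem r c) → ∃[ vy ] fc c vx vy)
                × (¬ T (mem r c) → ∀ vy → ¬ fc c vx vy)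

  Valid : Reaction → Set
  Valid r = ∃[ vx ] fr r vx

  -- environment propositions e_r, one per valid reaction
  record ValidR : Set where
    constructor ⟨_,_⟩
    field
      reaction : Reaction
      .isValid : Valid reaction
  open ValidR public

  ⟦_⟧T : Fin n → ValX × ValY → Set
  ⟦ i ⟧T (vx , vy) = lit i vx vy

  WinningT : LTL (Fin n) → Strategy ValX ValY → Set
  WinningT φ ρ = ∀ (ι : ℕ → ValX) → Sat ⟦_⟧T (λ k → ι k , outAt ρ ι k) 0 φ

  Realizable : LTL (Fin n) → Set
  Realizable φ = Σ[ ρ ∈ Strategy ValX ValY ] WinningT φ ρ

  EnvVal : Set
  EnvVal = ValidR → Bool

  BAtom : Set
  BAtom = Fin n ⊎ ValidR

  ⟦_⟧B : BAtom → EnvVal × Choice → Set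
  ⟦ inj₁ i ⟧B (e , s) = T (lookup s i)
  ⟦ inj₂ r ⟧B (e , s) = T (e r)

  Legal : EnvVal × Choice → Set
  Legal (e , s) = Σ[ r ∈ ValidR ] (T (e r)
                    × (∀ r' → ¬ (reaction r' ≡ reaction r) → ¬ T (e r')))

  Extra : EnvVal × Choice → Set
  Extra (e , s) = ∀ (r : ValidR) → T (e r) →
    ∃[ c ] (T (mem (reaction r) c) × (∀ i → litVal (lookup c i) (T (lookup s i))))

  -- semantics of φ^B = φ^T[l_i ← s_i] ∧ □(φ^legal → φ^extra) on a trace
  SatB : LTL (Fin n) → (ℕ → EnvVal × Choice) → Set
  SatB φ σ = Sat ⟦_⟧B σ 0 (mapLTL inj₁ φ)
           × (∀ k → Legal (σ k) → Extra (σ k))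

  WinningB : LTL (Fin n) → Strategy EnvVal Choice → Set
  WinningB φ ρ = ∀ (ι : ℕ → EnvVal) → SatB φ (λ k → ι k , outAt ρ ι k)

  record Partitioner : Set where
    field
      α    : ValX → ValidR
      α-ok : ∀ vx (r : ValidR) → fr (reaction r) vx → reaction (α vx) ≡ reaction r

  -- α(v_x) as the valuation of ē making only α(v_x) true
  αVal : Partitioner → ValX → EnvVal
  αVal P vx r = eqPow (reaction r) (reaction (Partitioner.α P vx))

  record Description : Set₁ where
    field
      ψ    : (r : ValidR) (c : Choice) → T (mem (reaction r) c) →
             ValX → ValZ → ValY → Set
      ψ-ok : ∀ (r : ValidR) (c : Choice) (m : T (mem (reaction r) c)) vx vz →
             ∃[ vy ] ((fr (reaction r) vx → fc c vx vy) × ψ r c m vx vz vy)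

  record Provider : Set where
    field
      β    : ValX → ValZ → Choice → ValY
      β-ok : ∀ vx vz (r : ValidR) → fr (reaction r) vx →
             ∀ c → T (mem (reaction r) c) → fc c vx (β vx vz c)

  combined : Partitioner → Strategy EnvVal Choice → Provider →
             Strategy (ValX × ValZ) ValY
  combined P ρ B = record
    { size = Strategy.size ρ
    ; q₀   = Strategy.q₀ ρ
    ; δ    = λ q xz → Strategy.δ ρ q (αVal P (proj₁ xz))
    ; o    = λ q xz → Provider.β B (proj₁ xz) (proj₂ xz)
                        (Strategy.o ρ q (αVal P (proj₁ xz)))
    }

  WinningAdaptive : LTL (Fin n) → Strategy (ValX × ValZ) ValY → Set
  WinningAdaptive φ ρ = ∀ (ι : ℕ → ValX × ValZ) →
    Sat ⟦_⟧T (λ k → proj₁ (ι k) , outAt ρ ι k) 0 φ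

-- Along any play of the combined strategy, the Boolean strategy sees the input α(v_x), which is
-- legal by construction, so the winning condition of φ^B forces its choice c to satisfy φ^extra
-- and hence to lie in the reaction of v_x. The provider then realises c, i.e. the valuation
-- (v_x , β(v_x, v_z, c)) makes exactly the literals l_i with s_i ∈ c true. Atom by atom the
-- theory-level trace therefore agrees with the Boolean trace on φ^T[l_i ← s_i], so the two
-- traces satisfy the same LTL formulas.
module Submission where

open import Defs
open import Level using (0ℓ)
open import Axiom.ExcludedMiddle using (ExcludedMiddle)
open import Data.Bool using (Bool; true; false; T)
open import Data.Empty using (⊥-elim)
open import Data.Fin using (Fin)
open import Data.Nat using (ℕ; zero; suc)
open import Data.Product using (∃-syntax; _×_; _,_; proj₁; proj₂; uncurry)
open import Data.Product.Function.NonDependent.Propositional using (_×-⇔_)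
open import Data.Sum using (inj₁)
open import Data.Unit using (tt)
open import Data.Vec using (Vec; []; _∷_; lookup)
open import Function using (_∘_)
open import Function.Bundles using (_⇔_; mk⇔; Equivalence)
open import Function.Construct.Identity using (⇔-id)
open import Function.Related.TypeIsomorphisms using (¬-cong-⇔)
open import Relation.Nullary using (yes; no)
open import Relation.Nullary.Decidable using (⌊_⌋)
open import Relation.Binary.PropositionalEquality
  using (_≡_; refl; sym; cong; cong₂; subst)

open Equivalence using (to; from)

Sat-mapLTL : {A B S₁ S₂ : Set} (g : A → B) (⟦_⟧₁ : B → S₁ → Set) (⟦_⟧₂ : A → S₂ → Set)
  (σ₁ : ℕ → S₁) (σ₂ : ℕ → S₂) →
  (∀ k a → ⟦ g a ⟧₁ (σ₁ k) ⇔ ⟦ a ⟧₂ (σ₂ k)) →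
  ∀ i φ → Sat ⟦_⟧₁ σ₁ i (mapLTL g φ) ⇔ Sat ⟦_⟧₂ σ₂ i φ
Sat-mapLTL g ⟦_⟧₁ ⟦_⟧₂ σ₁ σ₂ atoms⇔ = go
  where
  go : ∀ i φ → Sat ⟦_⟧₁ σ₁ i (mapLTL g φ) ⇔ Sat ⟦_⟧₂ σ₂ i φ
  go i ttℓ      = ⇔-id _
  go i (atom a) = atoms⇔ i a
  go i (¬ℓ φ)   = ¬-cong-⇔ (go i φ)
  go i (φ ∧ℓ ψ) = go i φ ×-⇔ go i ψ
  go i (Xℓ φ)   = go (suc i) φ
  go i (φ Uℓ ψ) = mk⇔
    (λ (k , i≤k , ψₖ , φ<k) → k , i≤k , to (go k ψ) ψₖ , λ j i≤j j<k → to (go j φ) (φ<k j i≤j j<k))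
    (λ (k , i≤k , ψₖ , φ<k) → k , i≤k , from (go k ψ) ψₖ , λ j i≤j j<k → from (go j φ) (φ<k j i≤j j<k))

module _ {I J O P : Set} (f : J → I) (g : J → O → P) (ρ : Strategy I O) where
  open Strategy ρ

  adapt : Strategy J P
  adapt = record { size = size ; q₀ = q₀ ; δ = λ q j → δ q (f j) ; o = λ q j → g j (o q (f j)) }

  stateAt-adapt : ∀ ι k → stateAt adapt ι k ≡ stateAt ρ (f ∘ ι) k
  stateAt-adapt ι zero    = refl
  stateAt-adapt ι (suc k) = cong (λ q → δ q (f (ι k))) (stateAt-adapt ι k)

  outAt-adapt : ∀ ι k → outAt adapt ι k ≡ g (ι k) (outAt ρ (f ∘ ι) k)
  outAt-adapt ι k = cong (λ q → g (ι k) (o q (f (ι k)))) (stateAt-adapt ι k)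

tabulatePow : ∀ {n} → (Vec Bool n → Bool) → Pow n
tabulatePow {zero}  f = f []
tabulatePow {suc n} f = tabulatePow (f ∘ (true ∷_)) , tabulatePow (f ∘ (false ∷_))

mem-tabulatePow : ∀ {n} (f : Vec Bool n → Bool) c → mem (tabulatePow f) c ≡ f c
mem-tabulatePow {zero}  f []          = refl
mem-tabulatePow {suc n} f (true ∷ c)  = mem-tabulatePow (f ∘ (true ∷_)) c
mem-tabulatePow {suc n} f (false ∷ c) = mem-tabulatePow (f ∘ (false ∷_)) c

eqPow-refl : ∀ {n} (a : Pow n) → T (eqPow a a)
eqPow-refl {zero}  false   = tt
eqPow-refl {zero}  true    = tt
eqPow-refl {suc n} (a , b) with eqPow a a | eqPow-refl a | eqPow b b | eqPow-refl b
... | true | _ | true | _ = tt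

eqPow⇒≡ : ∀ {n} (a b : Pow n) → T (eqPow a b) → a ≡ b
eqPow⇒≡ {zero}  false   false   _ = refl
eqPow⇒≡ {zero}  true    true    _ = refl
eqPow⇒≡ {suc n} (a , b) (c , d) _ with eqPow a c | eqPow⇒≡ a c | eqPow b d | eqPow⇒≡ b d
... | true | a≡c | true | b≡d = cong₂ _,_ (a≡c tt) (b≡d tt)

litVal-T⇒≡ : ∀ x y → litVal x (T y) → x ≡ y
litVal-T⇒≡ true  true  _  = refl
litVal-T⇒≡ false false _  = refl
litVal-T⇒≡ false true  ¬t = ⊥-elim (¬t tt)

litVal-T-pointwise⇒≡ : ∀ {n} (c s : Vec Bool n) → (∀ i → litVal (lookup c i) (T (lookup s i))) → c ≡ s
litVal-T-pointwise⇒≡ []      []      _ = refl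
litVal-T-pointwise⇒≡ (x ∷ c) (y ∷ s) h =
  cong₂ _∷_ (litVal-T⇒≡ x y (h Fin.zero)) (litVal-T-pointwise⇒≡ c s (h ∘ Fin.suc))

litVal-⇔ : ∀ b {P} → litVal b P → T b ⇔ P
litVal-⇔ true  p  = mk⇔ (λ _ → p) (λ _ → tt)
litVal-⇔ false ¬p = mk⇔ (λ ()) (⊥-elim ∘ ¬p)

module _ (em : ExcludedMiddle 0ℓ) (𝒯 : Spec) (nz : ℕ) where
  open Spec 𝒯
  open Setup 𝒯 nz

  -- α-ok only speaks about reactions holding at v_x; excluded middle supplies one for every v_x.
  reactionOf : ValX → Reaction
  reactionOf vx = tabulatePow (λ c → ⌊ em {∃[ vy ] fc c vx vy} ⌋)

  fr-reactionOf : ∀ vx → fr (reactionOf vx) vx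
  fr-reactionOf vx c
    rewrite mem-tabulatePow (λ c → ⌊ em {∃[ vy ] fc c vx vy} ⌋) c
    with em {∃[ vy ] fc c vx vy}
  ... | yes sat = (λ _ → sat) , (λ ¬t → ⊥-elim (¬t tt))
  ... | no ¬sat = (λ ()) , (λ _ vy fcᵥ → ¬sat (vy , fcᵥ))

  module _ (P : Partitioner) where
    open Partitioner P

    fr-α : ∀ vx → fr (reaction (α vx)) vx
    fr-α vx = subst (λ r → fr r vx)
      (sym (α-ok vx ⟨ reactionOf vx , (vx , fr-reactionOf vx) ⟩ (fr-reactionOf vx)))
      (fr-reactionOf vx)

    legal-αVal : ∀ vx s → Legal (αVal P vx , s)
    legal-αVal vx s = α vx , eqPow-refl (reaction (α vx)) , λ r r≢α t → r≢α (eqPow⇒≡ _ _ t)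

    extra-αVal⇒mem : ∀ vx s → Extra (αVal P vx , s) → T (mem (reaction (α vx)) s)
    extra-αVal⇒mem vx s extra with extra (α vx) (eqPow-refl (reaction (α vx)))
    ... | c , c∈α , c≈s = subst (T ∘ mem (reaction (α vx))) (litVal-T-pointwise⇒≡ c s c≈s) c∈α

theorem3 : ExcludedMiddle 0ℓ →
    (𝒯 : Spec) (nz : ℕ) (φT : LTL (Fin (Spec.n 𝒯))) →
    let open Setup 𝒯 nz in
    Realizable φT →
    (α : Partitioner) (Γ : Description) (β : Provider)
    (ρB : Strategy EnvVal Choice) →
    WinningB φT ρB →
    WinningAdaptive φT (combined α ρB β)
-- Neither realizability of φ^T nor the description Γ is needed: β-ok alone is what is used of β.
theorem3 em 𝒯 nz φT _ P _ B ρB win ι =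
  to (Sat-mapLTL inj₁ ⟦_⟧B ⟦_⟧T σB σT atoms⇔ 0 φT) (proj₁ (win ιB))
  where
  open Setup 𝒯 nz
  open Provider B

  ιB : ℕ → EnvVal
  ιB = αVal P ∘ proj₁ ∘ ι

  σB : ℕ → EnvVal × Choice
  σB k = ιB k , outAt ρB ιB k

  σT : ℕ → ValX × ValY
  σT k = proj₁ (ι k) , outAt (combined P ρB B) ι k

  -- combined P ρB B is definitionally adapt (αVal P ∘ proj₁) (uncurry β) ρB.
  realised : ∀ k → fc (outAt ρB ιB k) (proj₁ (ι k)) (proj₂ (σT k))
  realised k = subst (fc s vx) (sym (outAt-adapt (αVal P ∘ proj₁) (uncurry β) ρB ι k))
    (β-ok vx vz (Partitioner.α P vx) (fr-α em 𝒯 nz P vx) s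
      (extra-αVal⇒mem em 𝒯 nz P vx s (proj₂ (win ιB) k (legal-αVal em 𝒯 nz P vx s))))
    where
    vx : ValX
    vx = proj₁ (ι k)
    vz : ValZ
    vz = proj₂ (ι k)
    s : Choice
    s = outAt ρB ιB k

  atoms⇔ : ∀ k i → ⟦ inj₁ i ⟧B (σB k) ⇔ ⟦ i ⟧T (σT k)
  atoms⇔ k i = litVal-⇔ (lookup (outAt ρB ιB k) i) (realised k i)
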